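{- Let $b$ and $n$ be positive integers with $b>1$. Suppose $s_i,t_i\in\mathbb{Z}$ for every $i\in\mathbb{Z}/n\mathbb{Z}$ satisfy $\sum_{i\in\mathbb{Z}/n\mathbb{Z}}s_ib^i\equiv\sum_{i\in\mathbb{Z}/n\mathbb{Z}}t_ib^i\pmod{b^n-1}$ (where $b^i$ is computed modulo $b^n-1$). Then there is a unique collection of integers $\{c_i\}_{i\in\mathbb{Z}/n\mathbb{Z}}$ such that \[ s_i+c_{i-1}=t_i+bc_i\quad\text{for all } i\in\mathbb{Z}/n\mathbb{Z}; \] these are given by \[ c_i=\frac{1}{b^n-1}\sum_{j=0}^{n-1}\bigl(s_{j+i+1}-t_{j+i+1}\bigr)b^j\qquad(i\in\mathbb{Z}/n\mathbb{Z}), \] with indices taken in $\mathbb{Z}/n\mathbb{Z}$. Furthermore, \[ \sum_{i\in\mathbb{Z}/n\mathbb{Z}}c_i=\frac{1}{b-1}\sum_{i\in\mathbb{Z}/n\mathbb{Z}}(s_i-t_i). \] -}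

module Defs where

open import Data.Nat as ℕ using (ℕ; NonZero)
open import Data.Nat.DivMod using (_mod_)
open import Data.Fin using (Fin; toℕ; zero; suc)
open import Data.Integer using (ℤ; _+_; _*_; _-_; +_; 0ℤ)

∑ : ∀ {n} → (Fin n → ℤ) → ℤ
∑ {ℕ.zero}  f = 0ℤ
∑ {ℕ.suc n} f = f zero + ∑ (λ i → f (suc i))

[_]ₙ : ∀ {n} .{{_ : NonZero n}} → ℕ → Fin n
[_]ₙ {n} k = k mod n

_⊕_ : ∀ {n} .{{_ : NonZero n}} → Fin n → ℕ → Fin n
i ⊕ k = [ toℕ i ℕ.+ k ]ₙ

prev : ∀ {n} .{{_ : NonZero n}} → Fin n → Fin n
prev {n} i = i ⊕ (n ℕ.∸ 1)

_^ℤ_ : ℕ → ℕ → ℤ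
b ^ℤ k = + (b ℕ.^ k)

module Submission where

-- Write δ m for s − t at m mod n and window m = ∑_{j<n} δ (m + j) b^j. Horner's rule
-- gives window m = b · window (m + 1) − (b^n − 1) δ m, so b^n − 1, which divides
-- window 0 by hypothesis, divides every window, and c_i = window (i + 1) / (b^n − 1)
-- solves the recurrence. Conversely, unrolling the recurrence of any solution once
-- around the cycle gives c_i = b^n c_i − window (i + 1): this is the closed formula,
-- hence uniqueness. Summing the recurrence over the cycle gives the last identity.

open import Defs
open import Data.Nat using (ℕ; NonZero; _<_)
import Data.Nat
open import Data.Fin using (Fin; toℕ)
open import Data.Integer using (ℤ; _+_; _*_; _-_; +_; 1ℤ)
open import Data.Integer.Divisibility using (_∣_)
open import Data.Product using (Σ; _×_)
open import Relation.Binary.PropositionalEquality using (_≡_)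

open import Data.Nat as ℕ using (zero; suc; pred; _%_)
import Data.Nat.Properties as ℕₚ
open import Data.Nat.DivMod using (%-distribˡ-+; m%n%n≡m%n; m%n<n; m<n⇒m%n≡m; [m+n]%n≡m%n; m*n%n≡0)
open import Data.Integer using (0ℤ; ≢-nonZero)
open import Data.Integer.Properties using (+-comm; +-assoc; *-zeroʳ; *-distribˡ-+; *-identityʳ; *-comm; pos-*; +-injective; i-j≡0⇒i≡j; *-cancelˡ-≡)
open import Data.Integer.Divisibility.Signed as Signed using (∣ᵤ⇒∣; ∣m∣n⇒∣m-n; ∣n⇒∣m*n; ∣m⇒∣m*n)
open import Data.Integer.Tactic.RingSolver using (solve-∀)
import Data.Fin as Fin
open import Algebra.Properties.AbelianGroup Data.Integer.Properties.+-0-abelianGroup using (∙-cancelˡ)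
open import Data.Fin.Properties using (toℕ-injective; toℕ-fromℕ<; toℕ<n)
open import Data.Product using (_,_)
open import Function using (_∘_)
open import Relation.Binary.PropositionalEquality using (refl; sym; trans; cong; cong₂; subst; _≢_; module ≡-Reasoning)

open ≡-Reasoning

∑-cong : ∀ {k} {f g : Fin k → ℤ} → (∀ i → f i ≡ g i) → ∑ f ≡ ∑ g
∑-cong {zero}  f≗g = refl
∑-cong {suc k} f≗g = cong₂ _+_ (f≗g Fin.zero) (∑-cong (f≗g ∘ Fin.suc))

∑-+ : ∀ {k} (f g : Fin k → ℤ) → ∑ (λ i → f i + g i) ≡ ∑ f + ∑ g
∑-+ {zero}  f g = refl
∑-+ {suc k} f g = trans (cong (_+_ (f _ + g _)) (∑-+ (f ∘ Fin.suc) (g ∘ Fin.suc)))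
  (interchange (f Fin.zero) (g Fin.zero) (∑ (f ∘ Fin.suc)) (∑ (g ∘ Fin.suc)))
  where
  interchange : ∀ a b c d → a + b + (c + d) ≡ a + c + (b + d)
  interchange = solve-∀

∑-- : ∀ {k} (f g : Fin k → ℤ) → ∑ (λ i → f i - g i) ≡ ∑ f - ∑ g
∑-- {zero}  f g = refl
∑-- {suc k} f g = trans (cong (_+_ (f _ - g _)) (∑-- (f ∘ Fin.suc) (g ∘ Fin.suc)))
  (interchange (f Fin.zero) (g Fin.zero) (∑ (f ∘ Fin.suc)) (∑ (g ∘ Fin.suc)))
  where
  interchange : ∀ a b c d → a - b + (c - d) ≡ a + c - (b + d)
  interchange = solve-∀

*-distribˡ-∑ : ∀ {k} x (f : Fin k → ℤ) → x * ∑ f ≡ ∑ (λ i → x * f i)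
*-distribˡ-∑ {zero}  x f = *-zeroʳ x
*-distribˡ-∑ {suc k} x f = trans (*-distribˡ-+ x _ _) (cong (_+_ (x * f _)) (*-distribˡ-∑ x (f ∘ Fin.suc)))

∑< : ℕ → (ℕ → ℤ) → ℤ
∑< k g = ∑ {k} (g ∘ toℕ)

∑<-snoc : ∀ k (g : ℕ → ℤ) → ∑< (suc k) g ≡ ∑< k g + g k
∑<-snoc zero    g = +-comm (g 0) 0ℤ
∑<-snoc (suc k) g = trans (cong (_+_ (g 0)) (∑<-snoc k (g ∘ suc))) (sym (+-assoc (g 0) _ _))

∑<-rotate : ∀ k (g : ℕ → ℤ) → g k ≡ g 0 → ∑< k (g ∘ suc) ≡ ∑< k g
∑<-rotate k g gₖ≡g₀ = ∙-cancelˡ (g 0) _ _ (begin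
  g 0 + ∑< k (g ∘ suc) ≡⟨ ∑<-snoc k g ⟩
  ∑< k g + g k         ≡⟨ cong (_+_ (∑< k g)) gₖ≡g₀ ⟩
  ∑< k g + g 0         ≡⟨ +-comm (∑< k g) (g 0) ⟩
  g 0 + ∑< k g         ∎)

^ℤ-suc : ∀ b k → b ^ℤ suc k ≡ + b * b ^ℤ k
^ℤ-suc b k = pos-* b (b ℕ.^ k)

fromDigits : ℕ → ℕ → (ℕ → ℤ) → ℤ
fromDigits b k F = ∑< k (λ j → F j * b ^ℤ j)

fromDigits-horner : ∀ b k (F : ℕ → ℤ) →
  fromDigits b k F + F k * b ^ℤ k ≡ F 0 + + b * fromDigits b k (F ∘ suc)
fromDigits-horner b k F = begin
  fromDigits b k F + F k * b ^ℤ k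
    ≡⟨ sym (∑<-snoc k (λ j → F j * b ^ℤ j)) ⟩
  F 0 * 1ℤ + ∑< k (λ j → F (suc j) * b ^ℤ suc j)
    ≡⟨ cong₂ _+_ (*-identityʳ (F 0)) (∑-cong {k} (λ j → shift (F (suc (toℕ j))) (toℕ j))) ⟩
  F 0 + ∑< k (λ j → + b * (F (suc j) * b ^ℤ j))
    ≡⟨ cong (_+_ (F 0)) (sym (*-distribˡ-∑ {k} (+ b) _)) ⟩
  F 0 + + b * fromDigits b k (F ∘ suc) ∎
  where
  shift : ∀ x j → x * b ^ℤ suc j ≡ + b * (x * b ^ℤ j)
  shift x j = trans (cong (x *_) (^ℤ-suc b j)) (reassoc x (+ b) (b ^ℤ j))
    where
    reassoc : ∀ x y z → x * (y * z) ≡ y * (x * z)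
    reassoc = solve-∀

fromDigits-unroll : ∀ b (g F : ℕ → ℤ) → (∀ m → g m ≡ + b * g (suc m) - F m) →
  ∀ k m → g m ≡ b ^ℤ k * g (m ℕ.+ k) - fromDigits b k (λ j → F (m ℕ.+ j))
fromDigits-unroll b g F rec zero m = begin
  g m                  ≡⟨ unit (g m) ⟩
  1ℤ * g m - 0ℤ        ≡⟨ cong (λ i → 1ℤ * g i - 0ℤ) (sym (ℕₚ.+-identityʳ m)) ⟩
  1ℤ * g (m ℕ.+ 0) - 0ℤ ∎
  where
  unit : ∀ x → x ≡ 1ℤ * x - 0ℤ
  unit = solve-∀
fromDigits-unroll b g F rec (suc k) m = begin
  g m
    ≡⟨ fromDigits-unroll b g F rec k m ⟩
  b ^ℤ k * g (m ℕ.+ k) - D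
    ≡⟨ cong (λ x → b ^ℤ k * x - D) (rec (m ℕ.+ k)) ⟩
  b ^ℤ k * (+ b * g (suc (m ℕ.+ k)) - F (m ℕ.+ k)) - D
    ≡⟨ regroup (b ^ℤ k) (+ b) _ _ D ⟩
  + b * b ^ℤ k * g (suc (m ℕ.+ k)) - (D + F (m ℕ.+ k) * b ^ℤ k)
    ≡⟨ cong₂ (λ p i → p * g i - (D + F (m ℕ.+ k) * b ^ℤ k)) (sym (^ℤ-suc b k)) (sym (ℕₚ.+-suc m k)) ⟩
  b ^ℤ suc k * g (m ℕ.+ suc k) - (D + F (m ℕ.+ k) * b ^ℤ k)
    ≡⟨ cong (b ^ℤ suc k * g (m ℕ.+ suc k) -_) (sym (∑<-snoc k (λ j → F (m ℕ.+ j) * b ^ℤ j))) ⟩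
  b ^ℤ suc k * g (m ℕ.+ suc k) - fromDigits b (suc k) (λ j → F (m ℕ.+ j)) ∎
  where
  D : ℤ
  D = fromDigits b k (λ j → F (m ℕ.+ j))
  regroup : ∀ p x y z d → p * (x * y - z) - d ≡ x * p * y - (d + z * p)
  regroup = solve-∀

descend : ∀ {p} {P : ℕ → Set p} → (∀ m → P (suc m) → P m) → ∀ k m → P (k ℕ.+ m) → P m
descend step zero    m p = p
descend step (suc k) m p = descend step k m (step (k ℕ.+ m) p)

b^n-1≢0 : ∀ b n .{{_ : NonZero n}} → 1 < b → b ^ℤ n - 1ℤ ≢ 0ℤ
b^n-1≢0 b n 1<b b^n-1≡0 = ℕₚ.<-irrefl (sym b^n≡1) (ℕₚ.^-monoʳ-< b 1<b (ℕ.>-nonZero⁻¹ n))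
  where
  b^n≡1 : b ℕ.^ n ≡ 1
  b^n≡1 = +-injective (i-j≡0⇒i≡j (b ^ℤ n) 1ℤ b^n-1≡0)

module _ {n : ℕ} .{{_ : NonZero n}} where

  toℕ-[] : ∀ m → toℕ ([_]ₙ {n} m) ≡ m % n
  toℕ-[] m = toℕ-fromℕ< (m%n<n m n)

  []-cong-% : ∀ {a a′} → a % n ≡ a′ % n → [_]ₙ {n} a ≡ [ a′ ]ₙ
  []-cong-% {a} {a′} a≡a′ = toℕ-injective (trans (toℕ-[] a) (trans a≡a′ (sym (toℕ-[] a′))))

  [toℕ] : ∀ (i : Fin n) → [ toℕ i ]ₙ ≡ i
  [toℕ] i = toℕ-injective (trans (toℕ-[] (toℕ i)) (m<n⇒m%n≡m (toℕ<n i)))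

  []-⊕ : ∀ m k → [_]ₙ {n} m ⊕ k ≡ [ m ℕ.+ k ]ₙ
  []-⊕ m k = []-cong-% (begin
    (toℕ ([_]ₙ {n} m) ℕ.+ k) % n  ≡⟨ cong (λ x → (x ℕ.+ k) % n) (toℕ-[] m) ⟩
    (m % n ℕ.+ k) % n             ≡⟨ %-distribˡ-+ (m % n) k n ⟩
    (m % n % n ℕ.+ k % n) % n     ≡⟨ cong (λ x → (x ℕ.+ k % n) % n) (m%n%n≡m%n m n) ⟩
    (m % n ℕ.+ k % n) % n         ≡⟨ sym (%-distribˡ-+ m k n) ⟩
    (m ℕ.+ k) % n                 ∎)

  [+n] : ∀ m → [_]ₙ {n} (m ℕ.+ n) ≡ [ m ]ₙ
  [+n] m = []-cong-% ([m+n]%n≡m%n m n)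

  [n*m] : ∀ m → [_]ₙ {n} (n ℕ.* m) ≡ [ 0 ]ₙ
  [n*m] m = []-cong-% (begin
    (n ℕ.* m) % n ≡⟨ cong (_% n) (ℕₚ.*-comm n m) ⟩
    (m ℕ.* n) % n ≡⟨ m*n%n≡0 m n ⟩
    0             ≡⟨ sym (m<n⇒m%n≡m (ℕ.>-nonZero⁻¹ n)) ⟩
    0 % n         ∎)

  prev-⊕1 : ∀ (i : Fin n) → prev i ⊕ 1 ≡ i
  prev-⊕1 i = begin
    prev i ⊕ 1                         ≡⟨ []-⊕ (toℕ i ℕ.+ pred n) 1 ⟩
    [ toℕ i ℕ.+ pred n ℕ.+ 1 ]ₙ        ≡⟨ cong [_]ₙ (ℕₚ.+-assoc (toℕ i) (pred n) 1) ⟩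
    [ toℕ i ℕ.+ (pred n ℕ.+ 1) ]ₙ      ≡⟨ cong (λ k → [ toℕ i ℕ.+ k ]ₙ) (trans (ℕₚ.+-comm (pred n) 1) (ℕₚ.suc-pred n)) ⟩
    [ toℕ i ℕ.+ n ]ₙ                   ≡⟨ [+n] (toℕ i) ⟩
    [ toℕ i ]ₙ                         ≡⟨ [toℕ] i ⟩
    i                                  ∎

  prev-[suc] : ∀ m → prev ([_]ₙ {n} (suc m)) ≡ [ m ]ₙ
  prev-[suc] m = begin
    prev [ suc m ]ₙ             ≡⟨ []-⊕ (suc m) (pred n) ⟩
    [ suc (m ℕ.+ pred n) ]ₙ     ≡⟨ cong [_]ₙ (sym (ℕₚ.+-suc m (pred n))) ⟩
    [ m ℕ.+ suc (pred n) ]ₙ     ≡⟨ cong (λ k → [ m ℕ.+ k ]ₙ) (ℕₚ.suc-pred n) ⟩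
    [ m ℕ.+ n ]ₙ                ≡⟨ [+n] m ⟩
    [ m ]ₙ                      ∎

  ∑-prev : ∀ (f : Fin n → ℤ) → ∑ (f ∘ prev) ≡ ∑ f
  ∑-prev f = begin
    ∑ (f ∘ prev)                        ≡⟨ ∑-cong (λ i → cong (f ∘ prev) (sym ([toℕ] i))) ⟩
    ∑< n (λ m → f (prev [ m ]ₙ))        ≡⟨ sym (∑<-rotate n (λ m → f (prev [ m ]ₙ)) (cong (f ∘ prev) ([+n] 0))) ⟩
    ∑< n (λ m → f (prev [ suc m ]ₙ))    ≡⟨ ∑-cong {n} (λ i → cong f (prev-[suc] (toℕ i))) ⟩
    ∑< n (λ m → f [ m ]ₙ)               ≡⟨ ∑-cong (λ i → cong f ([toℕ] i)) ⟩
    ∑ f                                 ∎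

module Carries (b n : ℕ) .{{_ : NonZero n}} (1<b : 1 < b) (s t : Fin n → ℤ) where

  N : ℤ
  N = b ^ℤ n - 1ℤ

  instance
    N-nonZero : Data.Integer.NonZero N
    N-nonZero = ≢-nonZero (b^n-1≢0 b n 1<b)

  δ : ℕ → ℤ
  δ m = s [ m ]ₙ - t [ m ]ₙ

  window : ℕ → ℤ
  window m = fromDigits b n (λ j → δ (m ℕ.+ j))

  IsCarry : (Fin n → ℤ) → Set
  IsCarry c = ∀ i → s i + c (prev i) ≡ t i + + b * c i

  δ-toℕ : ∀ i → δ (toℕ i) ≡ s i - t i
  δ-toℕ i = cong (λ j → s j - t j) ([toℕ] i)

  window-cong : ∀ {a a′} → [_]ₙ {n} a ≡ [ a′ ]ₙ → window a ≡ window a′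
  window-cong {a} {a′} a≡a′ = ∑-cong {n} (λ j → cong (λ i → (s i - t i) * b ^ℤ toℕ j)
    (trans (sym ([]-⊕ a (toℕ j))) (trans (cong (_⊕ toℕ j) a≡a′) ([]-⊕ a′ (toℕ j)))))

  window-step : ∀ m → window m ≡ + b * window (suc m) - N * δ m
  window-step m = isolate (window m) (δ m) (window (suc m)) (begin
    window m + δ m * b ^ℤ n                            ≡⟨ cong (λ i → window m + (s i - t i) * b ^ℤ n) (sym ([+n] m)) ⟩
    window m + δ (m ℕ.+ n) * b ^ℤ n                    ≡⟨ fromDigits-horner b n (λ j → δ (m ℕ.+ j)) ⟩
    δ (m ℕ.+ 0) + + b * fromDigits b n (λ j → δ (m ℕ.+ suc j))
      ≡⟨ cong₂ (λ k w → δ k + + b * w) (ℕₚ.+-identityʳ m) (∑-cong {n} (λ j → cong (λ k → δ k * b ^ℤ toℕ j) (ℕₚ.+-suc m (toℕ j)))) ⟩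
    δ m + + b * window (suc m)                         ∎)
    where
    isolate : ∀ x y z → x + y * b ^ℤ n ≡ y + + b * z → x ≡ + b * z - N * y
    isolate x y z eq = begin
      x                             ≡⟨ cancel x (y * b ^ℤ n) ⟩
      x + y * b ^ℤ n - y * b ^ℤ n   ≡⟨ cong (_- y * b ^ℤ n) eq ⟩
      y + + b * z - y * b ^ℤ n      ≡⟨ rearrange y (+ b * z) (b ^ℤ n) ⟩
      + b * z - N * y               ∎
      where
      cancel : ∀ x y → x ≡ x + y - y
      cancel = solve-∀
      rearrange : ∀ y z p → y + z - y * p ≡ z - (p - 1ℤ) * y
      rearrange = solve-∀

  IsCarry⇒recurrence : ∀ {c} → IsCarry c → ∀ m → c [ m ]ₙ ≡ + b * c [ suc m ]ₙ - δ (suc m)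
  IsCarry⇒recurrence {c} carry m = begin
    c [ m ]ₙ                                           ≡⟨ cong c (sym (prev-[suc] m)) ⟩
    c (prev [ suc m ]ₙ)                                ≡⟨ cancel (s [ suc m ]ₙ) _ ⟩
    s [ suc m ]ₙ + c (prev [ suc m ]ₙ) - s [ suc m ]ₙ  ≡⟨ cong (_- s [ suc m ]ₙ) (carry [ suc m ]ₙ) ⟩
    t [ suc m ]ₙ + + b * c [ suc m ]ₙ - s [ suc m ]ₙ   ≡⟨ rearrange (s [ suc m ]ₙ) (t [ suc m ]ₙ) _ ⟩
    + b * c [ suc m ]ₙ - δ (suc m)                     ∎
    where
    cancel : ∀ x y → y ≡ x + y - x
    cancel = solve-∀
    rearrange : ∀ x y z → y + z - x ≡ z - (x - y)
    rearrange = solve-∀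

  IsCarry⇒formula : ∀ {c} → IsCarry c →
    ∀ i → N * c i ≡ fromDigits b n (λ j → δ (toℕ i ℕ.+ (j ℕ.+ 1)))
  IsCarry⇒formula {c} carry i = begin
    N * c i
      ≡⟨ solve-for (c i) _ periodic ⟩
    fromDigits b n (λ j → δ (suc (toℕ i ℕ.+ j)))
      ≡⟨ ∑-cong {n} (λ j → cong (λ k → δ k * b ^ℤ toℕ j) (trans (sym (ℕₚ.+-suc (toℕ i) (toℕ j))) (cong (toℕ i ℕ.+_) (ℕₚ.+-comm 1 (toℕ j))))) ⟩
    fromDigits b n (λ j → δ (toℕ i ℕ.+ (j ℕ.+ 1))) ∎
    where
    X : ℤ
    X = fromDigits b n (λ j → δ (suc (toℕ i ℕ.+ j)))
    periodic : c i ≡ b ^ℤ n * c i - X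
    periodic = begin
      c i                              ≡⟨ cong c (sym ([toℕ] i)) ⟩
      c [ toℕ i ]ₙ                     ≡⟨ fromDigits-unroll b (c ∘ [_]ₙ) (δ ∘ suc) (IsCarry⇒recurrence carry) n (toℕ i) ⟩
      b ^ℤ n * c [ toℕ i ℕ.+ n ]ₙ - X   ≡⟨ cong (λ j → b ^ℤ n * c j - X) (trans ([+n] (toℕ i)) ([toℕ] i)) ⟩
      b ^ℤ n * c i - X                 ∎
    solve-for : ∀ x y → x ≡ b ^ℤ n * x - y → N * x ≡ y
    solve-for x y eq = begin
      N * x                          ≡⟨ distrib (b ^ℤ n) x ⟩
      b ^ℤ n * x - x                 ≡⟨ cong (b ^ℤ n * x -_) eq ⟩
      b ^ℤ n * x - (b ^ℤ n * x - y)  ≡⟨ cancel (b ^ℤ n * x) y ⟩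
      y                              ∎
      where
      distrib : ∀ p x → (p - 1ℤ) * x ≡ p * x - x
      distrib = solve-∀
      cancel : ∀ a y → a - (a - y) ≡ y
      cancel = solve-∀

  IsCarry-unique : ∀ {c c′} → IsCarry c → IsCarry c′ → ∀ i → c′ i ≡ c i
  IsCarry-unique {c} {c′} carry carry′ i =
    *-cancelˡ-≡ N (c′ i) (c i) (trans (IsCarry⇒formula carry′ i) (sym (IsCarry⇒formula carry i)))

  IsCarry⇒sum : ∀ {c} → IsCarry c → (+ b - 1ℤ) * ∑ c ≡ ∑ (λ i → s i - t i)
  IsCarry⇒sum {c} carry = begin
    (+ b - 1ℤ) * ∑ c                 ≡⟨ expand (+ b) (∑ c) (∑ t) ⟩
    ∑ t + + b * ∑ c - ∑ c - ∑ t      ≡⟨ cong (λ x → x - ∑ c - ∑ t) (sym summed) ⟩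
    ∑ s + ∑ c - ∑ c - ∑ t            ≡⟨ cancel (∑ s) (∑ c) (∑ t) ⟩
    ∑ s - ∑ t                        ≡⟨ sym (∑-- s t) ⟩
    ∑ (λ i → s i - t i)              ∎
    where
    summed : ∑ s + ∑ c ≡ ∑ t + + b * ∑ c
    summed = begin
      ∑ s + ∑ c                          ≡⟨ cong (_+_ (∑ s)) (sym (∑-prev c)) ⟩
      ∑ s + ∑ (c ∘ prev)                 ≡⟨ sym (∑-+ s (c ∘ prev)) ⟩
      ∑ (λ i → s i + c (prev i))         ≡⟨ ∑-cong carry ⟩
      ∑ (λ i → t i + + b * c i)          ≡⟨ ∑-+ t (λ i → + b * c i) ⟩
      ∑ t + ∑ (λ i → + b * c i)          ≡⟨ cong (_+_ (∑ t)) (sym (*-distribˡ-∑ (+ b) c)) ⟩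
      ∑ t + + b * ∑ c                    ∎
    expand : ∀ x y z → (x - 1ℤ) * y ≡ z + x * y - y - z
    expand = solve-∀
    cancel : ∀ x y z → x + y - y - z ≡ x - z
    cancel = solve-∀

  IsCarry-exists : N ∣ (∑ (λ i → s i * (b ^ℤ toℕ i)) - ∑ (λ i → t i * (b ^ℤ toℕ i))) →
    Σ (Fin n → ℤ) IsCarry
  IsCarry-exists N∣ = c , carry
    where
    window-0 : window 0 ≡ ∑ (λ i → s i * (b ^ℤ toℕ i)) - ∑ (λ i → t i * (b ^ℤ toℕ i))
    window-0 = trans (∑-cong {n} (λ j → trans (cong (_* b ^ℤ toℕ j) (δ-toℕ j)) (distrib (s j) (t j) _)))
                     (∑-- (λ i → s i * (b ^ℤ toℕ i)) (λ i → t i * (b ^ℤ toℕ i)))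
      where
      distrib : ∀ x y z → (x - y) * z ≡ x * z - y * z
      distrib = solve-∀

    N∣window-suc⇒N∣window : ∀ m → N Signed.∣ window (suc m) → N Signed.∣ window m
    N∣window-suc⇒N∣window m N∣w = subst (N Signed.∣_) (sym (window-step m))
      (∣m∣n⇒∣m-n (∣n⇒∣m*n (+ b) N∣w) (∣m⇒∣m*n (δ m) Signed.∣-refl))

    N∣window : ∀ m → N Signed.∣ window m
    N∣window m = descend N∣window-suc⇒N∣window (n ℕ.* m ℕ.∸ m) m
      (subst (N Signed.∣_) (sym (window-cong [n*m∸m+m])) (subst (N Signed.∣_) (sym window-0) (∣ᵤ⇒∣ N∣)))
      where
      [n*m∸m+m] : [_]ₙ {n} (n ℕ.* m ℕ.∸ m ℕ.+ m) ≡ [ 0 ]ₙ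
      [n*m∸m+m] = trans (cong [_]ₙ (ℕₚ.m∸n+n≡m (ℕₚ.m≤n*m m n))) ([n*m] m)

    q : Fin n → ℤ
    q i = Signed.quotient (N∣window (toℕ i))

    N*q : ∀ i → N * q i ≡ window (toℕ i)
    N*q i = trans (*-comm N (q i)) (sym (Signed._∣_.equality (N∣window (toℕ i))))

    c : Fin n → ℤ
    c i = q (i ⊕ 1)

    c-prev : ∀ i → c (prev i) ≡ + b * c i - (s i - t i)
    c-prev i = *-cancelˡ-≡ N _ _ (begin
      N * c (prev i)                                ≡⟨ cong (λ j → N * q j) (prev-⊕1 i) ⟩
      N * q i                                       ≡⟨ N*q i ⟩
      window (toℕ i)                                ≡⟨ window-step (toℕ i) ⟩
      + b * window (suc (toℕ i)) - N * δ (toℕ i)    ≡⟨ cong₂ (λ w d → + b * w - N * d) (window-cong [suc]≡[⊕1]) (δ-toℕ i) ⟩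
      + b * window (toℕ (i ⊕ 1)) - N * (s i - t i)  ≡⟨ cong (λ w → + b * w - N * (s i - t i)) (sym (N*q (i ⊕ 1))) ⟩
      + b * (N * c i) - N * (s i - t i)             ≡⟨ factor (+ b) N (c i) (s i - t i) ⟩
      N * (+ b * c i - (s i - t i))                 ∎)
      where
      [suc]≡[⊕1] : [_]ₙ {n} (suc (toℕ i)) ≡ [ toℕ (i ⊕ 1) ]ₙ
      [suc]≡[⊕1] = trans (cong [_]ₙ (ℕₚ.+-comm 1 (toℕ i))) (sym ([toℕ] (i ⊕ 1)))
      factor : ∀ x y z w → x * (y * z) - y * w ≡ y * (x * z - w)
      factor = solve-∀

    carry : IsCarry c
    carry i = trans (cong (_+_ (s i)) (c-prev i)) (rearrange (s i) (t i) (+ b * c i))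
      where
      rearrange : ∀ x y z → x + (z - (x - y)) ≡ y + z
      rearrange = solve-∀

lemma4p4 : (b n : ℕ) .{{_ : NonZero n}} → 1 < b →
    (s t : Fin n → ℤ) →
    ((b ^ℤ n) - 1ℤ) ∣ (∑ (λ i → s i * (b ^ℤ toℕ i)) - ∑ (λ i → t i * (b ^ℤ toℕ i))) →
    Σ (Fin n → ℤ) (λ c →
      (∀ i → s i + c (prev i) ≡ t i + (+ b) * c i)
      × (∀ (c′ : Fin n → ℤ) → (∀ i → s i + c′ (prev i) ≡ t i + (+ b) * c′ i) → ∀ i → c′ i ≡ c i)
      × (∀ i → ((b ^ℤ n) - 1ℤ) * c i ≡ ∑ (λ (j : Fin n) → (s (i ⊕ (toℕ j Data.Nat.+ 1)) - t (i ⊕ (toℕ j Data.Nat.+ 1))) * (b ^ℤ toℕ j)))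
      × ((+ b - 1ℤ) * ∑ c ≡ ∑ (λ i → s i - t i)))
lemma4p4 b n 1<b s t N∣ =
  let open Carries b n 1<b s t
      (c , carry) = IsCarry-exists N∣
  in c , carry , (λ c′ carry′ → IsCarry-unique carry carry′) , IsCarry⇒formula carry , IsCarry⇒sum carry
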